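{- Let $\mathit{Atm}_0$ be finite. Then the logic $\mathsf{PLC}$ is sound and complete relative to the class $\mathbf{MDM}$: a formula of $\mathcal{L}$ is a theorem of $\mathsf{PLC}$ if and only if it is valid in every multi-decision model.
   Context: Let $\mathit{Atm}_0$ be a set of atomic propositions and $\mathit{Val}$ a finite set of output values; decision atoms $\mathsf{t}(x)$ for $x\in\mathit{Val}$, $\mathit{Dec}=\{\mathsf{t}(x):x\in\mathit{Val}\}$, $\mathit{Atm}=\mathit{Atm}_0\cup\mathit{Dec}$. Language $\mathcal{L}$: $\varphi ::= p \mid \mathsf{t}(x)\mid \neg\varphi\mid \varphi\wedge\varphi\mid \Box_{\mathtt{I}}\varphi\mid \Box_{\mathtt{F}}\varphi$ ($p\in\mathit{Atm}_0$, $x\in\mathit{Val}$). For finite $X,Y\subseteq\mathit{Atm}_0$ let $\mathrm{cn}_{X,Y}=\bigwedge_{p\in X}p\wedge\bigwedge_{p\in Y\setminus X}\neg p$. The logic $\mathsf{PLC}$ (for finite $\mathit{Atm}_0$) is the extension of classical propositional logic by the following axioms and rules, where $\blacksquare$ ranges over $\{\Box_{\mathtt{I}},\Box_{\mathtt{F}}\}$: K: $(\blacksquare\varphi\wedge\blacksquare(\varphi\to\psi))\to\blacksquare\psi$; T: $\blacksquare\varphi\to\varphi$; 4: $\blacksquare\varphi\to\blacksquare\blacksquare\varphi$; 5: $\neg\blacksquare\varphi\to\blacksquare\neg\blacksquare\varphi$; Comm: $\Box_{\mathtt{F}}\Box_{\mathtt{I}}\varphi\leftrightarrow\Box_{\mathtt{I}}\Box_{\mathtt{F}}\varphi$;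 AtLeast: $\bigvee_{x\in\mathit{Val}}\mathsf{t}(x)$; AtMost: $\mathsf{t}(x)\to\neg\mathsf{t}(y)$ for $x\neq y$; Funct: $(\mathrm{cn}_{X,\mathit{Atm}_0}\wedge\mathsf{t}(x))\to\Box_{\mathtt{I}}(\mathrm{cn}_{X,\mathit{Atm}_0}\to\mathsf{t}(x))$ for $X\subseteq\mathit{Atm}_0$, $x\in\mathit{Val}$; Indep: $p\to\Box_{\mathtt{F}}p$ and $\neg p\to\Box_{\mathtt{F}}\neg p$ for $p\in\mathit{Atm}_0$; Nec: from $\varphi$ infer $\blacksquare\varphi$. A multi-decision model (MDM) is a tuple $M=(W,\sim_{\Box_{\mathtt{I}}},\sim_{\Box_{\mathtt{F}}},V)$ with $W$ a set, $\sim_{\Box_{\mathtt{I}}},\sim_{\Box_{\mathtt{F}}}$ equivalence relations on $W$, $V:W\to2^{\mathit{Atm}}$, writing $V_Y(w)=V(w)\cap Y$, such that for all $w,v\in W$, $x,y\in\mathit{Val}$: (C1) $\sim_{\Box_{\mathtt{I}}}\circ\sim_{\Box_{\mathtt{F}}}=\sim_{\Box_{\mathtt{F}}}\circ\sim_{\Box_{\mathtt{I}}}$; (C2) if $V_{\mathit{Atm}_0}(w)=V_{\mathit{Atm}_0}(v)$ and $w\sim_{\Box_{\mathtt{I}}}v$ then $V_{\mathit{Dec}}(w)=V_{\mathit{Dec}}(v)$; (C3) if $w\sim_{\Box_{\mathtt{F}}}v$ then $V_{\mathit{Atm}_0}(w)=V_{\mathit{Atm}_0}(v)$; (C4) if $\mathsf{t}(x)\in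 V(w)$ and $x\neq y$ then $\mathsf{t}(y)\notin V(w)$; (C5) some $\mathsf{t}(x)\in V(w)$. Truth: atoms $q\in\mathit{Atm}$ true at $w$ iff $q\in V(w)$; Boolean connectives as usual; $\Box_{\mathtt{I}}\varphi$ (resp. $\Box_{\mathtt{F}}\varphi$) true at $w$ iff $\varphi$ true at all $\sim_{\Box_{\mathtt{I}}}$- (resp. $\sim_{\Box_{\mathtt{F}}}$-) related worlds. -}

module Defs where

open import Data.Nat using (ℕ; suc)
open import Data.Fin using (Fin; zero)
open import Data.Bool using (Bool; true; false; not; _∧_; if_then_else_)
open import Data.List using (List; foldr; map)
open import Data.List.Base using (allFin)
open import Data.Product using (_×_; Σ; ∃)
open import Relation.Nullary using (¬_)
open import Relation.Binary.PropositionalEquality using (_≡_; _≢_)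
open import Relation.Binary.Structures using (IsEquivalence)

-- Atm₀ = Fin n (finite), Val = Fin (suc m) (finite, nonempty)

data Mod : Set where
  I F : Mod

data Fm (n m : ℕ) : Set where
  atom : Fin n → Fm n m
  t    : Fin (suc m) → Fm n m
  ~_   : Fm n m → Fm n m
  _∧'_ : Fm n m → Fm n m → Fm n m
  □    : Mod → Fm n m → Fm n m

infix  30 ~_
infixr 20 _∧'_

module _ {n m : ℕ} where
  infixr 10 _⇒_
  infix  5  _⇔_
  _⇒_ : Fm n m → Fm n m → Fm n m
  φ ⇒ ψ = ~ (φ ∧' ~ ψ)

  _∨'_ : Fm n m → Fm n m → Fm n m
  φ ∨' ψ = ~ (~ φ ∧' ~ ψ)

  _⇔_ : Fm n m → Fm n m → Fm n m
  φ ⇔ ψ = (φ ⇒ ψ) ∧' (ψ ⇒ φ)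

  ⊤' : Fm n m
  ⊤' = t zero ⇒ t zero

  ⊥' : Fm n m
  ⊥' = ~ ⊤'

  ⋀ : List (Fm n m) → Fm n m
  ⋀ = foldr _∧'_ ⊤'

  ⋁ : List (Fm n m) → Fm n m
  ⋁ = foldr _∨'_ ⊥'

  cn : (Fin n → Bool) → Fm n m
  cn X = ⋀ (map (λ p → if X p then atom p else ~ atom p) (allFin n))

  -- classical propositional tautologies: true under every Boolean assignment
  -- to the maximal non-Boolean subformulas (atoms and boxed formulas)
  beval : (Fm n m → Bool) → Fm n m → Bool
  beval v (~ φ)    = not (beval v φ)
  beval v (φ ∧' ψ) = beval v φ ∧ beval v ψ
  beval v φ        = v φ

  Taut : Fm n m → Set
  Taut φ = (v : Fm n m → Bool) → beval v φ ≡ true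

  data Axiom : Fm n m → Set where
    taut   : ∀ {φ} → Taut φ → Axiom φ
    K      : ∀ k φ ψ → Axiom ((□ k φ ∧' □ k (φ ⇒ ψ)) ⇒ □ k ψ)
    T      : ∀ k φ → Axiom (□ k φ ⇒ φ)
    Four   : ∀ k φ → Axiom (□ k φ ⇒ □ k (□ k φ))
    Five   : ∀ k φ → Axiom (~ □ k φ ⇒ □ k (~ □ k φ))
    Comm   : ∀ φ → Axiom (□ F (□ I φ) ⇔ □ I (□ F φ))
    AtLeast : Axiom (⋁ (map t (allFin (suc m))))
    AtMost : ∀ x y → x ≢ y → Axiom (t x ⇒ ~ t y)
    Funct  : ∀ (X : Fin n → Bool) x → Axiom ((cn X ∧' t x) ⇒ □ I (cn X ⇒ t x))
    Indep⁺ : ∀ p → Axiom (atom p ⇒ □ F (atom p))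
    Indep⁻ : ∀ p → Axiom (~ atom p ⇒ □ F (~ atom p))

  data ⊢_ : Fm n m → Set where
    ax  : ∀ {φ} → Axiom φ → ⊢ φ
    mp  : ∀ {φ ψ} → ⊢ φ → ⊢ (φ ⇒ ψ) → ⊢ ψ
    nec : ∀ k {φ} → ⊢ φ → ⊢ □ k φ

record MDM (n m : ℕ) : Set₁ where
  field
    W     : Set
    R     : Mod → W → W → Set
    equiv : ∀ k → IsEquivalence (R k)
    V₀    : W → Fin n → Bool           -- V restricted to Atm₀
    Vd    : W → Fin (suc m) → Bool     -- V restricted to Dec
    C1→   : ∀ w v → Σ W (λ u → R I w u × R F u v) → Σ W (λ u → R F w u × R I u v)
    C1←   : ∀ w v → Σ W (λ u → R F w u × R I u v) → Σ W (λ u → R I w u × R F u v)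
    C2    : ∀ w v → (∀ p → V₀ w p ≡ V₀ v p) → R I w v → ∀ x → Vd w x ≡ Vd v x
    C3    : ∀ w v → R F w v → ∀ p → V₀ w p ≡ V₀ v p
    C4    : ∀ w x y → Vd w x ≡ true → x ≢ y → Vd w y ≡ false
    C5    : ∀ w → ∃ λ x → Vd w x ≡ true

module _ {n m : ℕ} (M : MDM n m) where
  open MDM M
  -- truth (classical: every clause is ¬¬-stable)
  _⊨_ : W → Fm n m → Set
  w ⊨ atom p   = V₀ w p ≡ true
  w ⊨ t x      = Vd w x ≡ true
  w ⊨ (~ φ)    = ¬ (w ⊨ φ)
  w ⊨ (φ ∧' ψ) = (w ⊨ φ) × (w ⊨ ψ)
  w ⊨ □ k φ    = ∀ v → R k w v → v ⊨ φ

Valid : ∀ {n m} → Fm n m → Set₁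
Valid {n} {m} φ = (M : MDM n m) (w : MDM.W M) → _⊨_ M w φ

{-# OPTIONS --safe #-}
-- Soundness is a check of each axiom against the frame conditions.  For completeness, PLC proves
-- the disjunction of the complete descriptions χ = γ ∧ σ ∧ δ ∧ τ, where γ fixes the valuation of
-- the atoms, δ says which decision table is in force on the current □I-class (Funct and AtLeast
-- guarantee that one is), σ lists the valuations occurring in that □I-class and τ the tables
-- occurring in the □F-class.  By Indep, 4, 5 and the Church–Rosser consequence of Comm, the parts
-- of χ are rigid along the right modality, so χ is either refuted outright or true at a world of
-- the finite model whose worlds are the admitted pairs (valuation, table), □I-related when they
-- share the table and □F-related when they share the valuation.  A truth lemma for that model
-- turns validity of φ into ⊢ χ ⇒ φ for every χ, hence ⊢ φ.
module Submission where

open import Defs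
open import Level using (0ℓ)
open import Function using (_∘_; id; _on_)
open import Function.Bundles using (Equivalence; Inverse; Injection)
open import Function.Properties.Inverse using (↔⇒↣)
open import Data.Nat using (ℕ; zero; suc; _^_)
import Data.Bool as Bool
open import Data.Bool using (Bool; true; false; not; _∧_; if_then_else_) renaming (T to So)
open import Data.Bool.Properties using (∧-conicalˡ; ∧-conicalʳ; T-≡; ¬-not)
import Data.Fin as Fin
open import Data.Fin using (Fin; zero; suc; combine; finToFun; funToFin)
open import Data.Fin.Properties using (all?; ¬∀⟶∃¬; 2↔Bool; funToFin-finToFin; finToFun-funToFin)
open import Data.Vec using (Vec; []; _∷_; lookup)
import Data.Vec as Vec
open import Data.Vec.Properties using (lookup-map)
import Data.Vec.Functional as Vector
open import Data.List using (List; []; _∷_; _++_; map; tabulate)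
open import Data.List.Base using (allFin)
open import Data.List.Properties using (tabulate-cong; map-tabulate)
open import Data.List.Relation.Unary.All as All using (All; []; _∷_)
import Data.List.Relation.Unary.All.Properties as All
open import Data.List.Relation.Unary.Any using (here; there)
open import Data.List.Membership.Propositional using (_∈_)
open import Data.List.Membership.Propositional.Properties using (∈-map⁺; ∈-tabulate⁺; ∈-allFin; ∈-++⁺ˡ; ∈-++⁺ʳ)
import Data.List.Membership.DecPropositional as DecMembership
open import Data.Product using (_×_; _,_; proj₁; proj₂; Σ)
open import Relation.Binary.Definitions using (DecidableEquality)
open import Relation.Binary.PropositionalEquality using (_≡_; _≗_; isEquivalence; refl; sym; trans; cong; cong₂; subst; module ≡-Reasoning)
import Relation.Binary.Construct.On as On
open import Relation.Binary.Structures using (IsEquivalence)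
open import Relation.Nullary using (¬_; Dec; yes; no; does; proof; Stable; contradiction; contradiction-irr)
open import Relation.Nullary.Decidable using (map′; ¬?; _×-dec_; decidable-stable; dec-true; dec-false; ¬¬-excluded-middle)
open import Relation.Nullary.Negation using (¬¬-Monad)
open import Relation.Nullary.Reflects using (Reflects; ¬-reflects; _×-reflects_; invert)

_≟ₘ_ : DecidableEquality Mod
I ≟ₘ I = yes refl
I ≟ₘ F = no λ ()
F ≟ₘ I = no λ ()
F ≟ₘ F = yes refl

module _ {n m : ℕ} where

  _≟_ : DecidableEquality (Fm n m)
  atom p ≟ atom q = map′ (cong atom) (λ { refl → refl }) (p Fin.≟ q)
  t x ≟ t y = map′ (cong t) (λ { refl → refl }) (x Fin.≟ y)
  (~ φ) ≟ (~ ψ) = map′ (cong ~_) (λ { refl → refl }) (φ ≟ ψ)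
  (φ ∧' ψ) ≟ (φ′ ∧' ψ′) = map′ (λ (e , e′) → cong₂ _∧'_ e e′) (λ { refl → refl , refl }) (φ ≟ φ′ ×-dec ψ ≟ ψ′)
  □ k φ ≟ □ l ψ = map′ (λ (e , e′) → cong₂ □ e e′) (λ { refl → refl , refl }) (k ≟ₘ l ×-dec φ ≟ ψ)
  atom _ ≟ t _ = no λ ()
  atom _ ≟ (~ _) = no λ ()
  atom _ ≟ (_ ∧' _) = no λ ()
  atom _ ≟ □ _ _ = no λ ()
  t _ ≟ atom _ = no λ ()
  t _ ≟ (~ _) = no λ ()
  t _ ≟ (_ ∧' _) = no λ ()
  t _ ≟ □ _ _ = no λ ()
  (~ _) ≟ atom _ = no λ ()
  (~ _) ≟ t _ = no λ ()
  (~ _) ≟ (_ ∧' _) = no λ ()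
  (~ _) ≟ □ _ _ = no λ ()
  (_ ∧' _) ≟ atom _ = no λ ()
  (_ ∧' _) ≟ t _ = no λ ()
  (_ ∧' _) ≟ (~ _) = no λ ()
  (_ ∧' _) ≟ □ _ _ = no λ ()
  □ _ _ ≟ atom _ = no λ ()
  □ _ _ ≟ t _ = no λ ()
  □ _ _ ≟ (~ _) = no λ ()
  □ _ _ ≟ (_ ∧' _) = no λ ()

  letters : Fm n m → List (Fm n m)
  letters (~ φ) = letters φ
  letters (φ ∧' ψ) = letters φ ++ letters ψ
  letters φ = φ ∷ []

module Soundness {n m : ℕ} (M : MDM n m) where
  open MDM M
  open DecMembership (_≟_ {n} {m}) using (_∈?_)

  infix 4 _⊩_
  _⊩_ : W → Fm n m → Set
  _⊩_ = _⊨_ M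

  ⊩-stable : ∀ φ w → Stable (w ⊩ φ)
  ⊩-stable (atom p) w = decidable-stable (V₀ w p Bool.≟ true)
  ⊩-stable (t x) w = decidable-stable (Vd w x Bool.≟ true)
  ⊩-stable (~ φ) w ¬¬¬φ w⊩φ = ¬¬¬φ (λ ¬φ → ¬φ w⊩φ)
  ⊩-stable (φ ∧' ψ) w ¬¬φψ =
    ⊩-stable φ w (λ ¬φ → ¬¬φψ (¬φ ∘ proj₁)) , ⊩-stable ψ w (λ ¬ψ → ¬¬φψ (¬ψ ∘ proj₂))
  ⊩-stable (□ k φ) w ¬¬□φ v r = ⊩-stable φ v (λ ¬φ → ¬¬□φ (λ □φ → ¬φ (□φ v r)))

  ⊩-⇒ : ∀ {φ ψ} w → w ⊩ (φ ⇒ ψ) → w ⊩ φ → w ⊩ ψ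
  ⊩-⇒ {ψ = ψ} w φ⇒ψ φ-holds = ⊩-stable ψ w (λ ¬ψ → φ⇒ψ (φ-holds , ¬ψ))

  ¬×¬-intro : ∀ {A B : Set} → (A → B) → ¬ (A × ¬ B)
  ¬×¬-intro f (a , ¬b) = ¬b (f a)

  ⊩-⋀ : ∀ {ψ L} w → w ⊩ ⋀ L → ψ ∈ L → w ⊩ ψ
  ⊩-⋀ w (ψ-holds , _) (here refl) = ψ-holds
  ⊩-⋀ w (_ , ⋀L-holds) (there ψ∈L) = ⊩-⋀ w ⋀L-holds ψ∈L

  ⊩-⋁ : ∀ {ψ L} w → ψ ∈ L → w ⊩ ψ → w ⊩ ⋁ L
  ⊩-⋁ w (here refl) ψ-holds (¬ψ , _) = ¬ψ ψ-holds
  ⊩-⋁ w (there ψ∈L) ψ-holds (_ , ¬⋁L) = ¬⋁L (⊩-⋁ w ψ∈L ψ-holds)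

  ⊩-cn : ∀ {X} w → w ⊩ cn X → ∀ p → V₀ w p ≡ X p
  ⊩-cn {X} w ⊩cn p = from-literal (X p) (⊩-⋀ w ⊩cn (∈-map⁺ _ (∈-allFin p)))
    where
      from-literal : ∀ b → w ⊩ (if b then atom p else ~ atom p) → V₀ w p ≡ b
      from-literal true  p-true = p-true
      from-literal false ¬p-true with V₀ w p
      ... | true  = contradiction refl ¬p-true
      ... | false = refl

  module _ (w : W) where

    assignment : (L : List (Fm n m)) → All (λ ψ → Dec (w ⊩ ψ)) L → Fm n m → Bool
    assignment L ds ψ with ψ ∈? L
    ... | yes ψ∈L = does (All.lookup ds ψ∈L)
    ... | no _    = false

    assignment-reflects : ∀ L ds {ψ} → ψ ∈ L → Reflects (w ⊩ ψ) (assignment L ds ψ)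
    assignment-reflects L ds {ψ} ψ∈L with ψ ∈? L
    ... | yes ψ∈L′ = proof (All.lookup ds ψ∈L′)
    ... | no ψ∉L   = contradiction ψ∈L ψ∉L

    beval-reflects : ∀ (v : Fm n m → Bool) φ → (∀ {ψ} → ψ ∈ letters φ → Reflects (w ⊩ ψ) (v ψ))
                   → Reflects (w ⊩ φ) (beval v φ)
    beval-reflects v (atom p) hyp = hyp (here refl)
    beval-reflects v (t x)    hyp = hyp (here refl)
    beval-reflects v (□ k φ)  hyp = hyp (here refl)
    beval-reflects v (~ φ)    hyp = ¬-reflects (beval-reflects v φ hyp)
    beval-reflects v (φ ∧' ψ) hyp =
      beval-reflects v φ (hyp ∘ ∈-++⁺ˡ) ×-reflects beval-reflects v ψ (hyp ∘ ∈-++⁺ʳ (letters φ))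

    -- Truth at w is ¬¬-stable, so we may decide the finitely many letters of φ and read off
    -- an assignment that agrees with w on them.
    taut-sound : ∀ {φ} → Taut φ → w ⊩ φ
    taut-sound {φ} φ-taut = ⊩-stable φ w λ ¬φ →
      All.sequenceM 0ℓ ¬¬-Monad (All.tabulate (λ _ → ¬¬-excluded-middle)) λ ds →
        let v = assignment (letters φ) ds in
        ¬φ (invert (subst (Reflects (w ⊩ φ)) (φ-taut v) (beval-reflects v φ (assignment-reflects _ ds))))

  module Eq k = IsEquivalence (equiv k)

  axiom-sound : ∀ {φ} → Axiom φ → ∀ w → w ⊩ φ
  axiom-sound (taut φ-taut) w = taut-sound w φ-taut
  axiom-sound (K k φ ψ) w = ¬×¬-intro λ (□φ , □φ⇒ψ) v r → ⊩-⇒ v (□φ⇒ψ v r) (□φ v r)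
  axiom-sound (T k φ) w = ¬×¬-intro λ □φ → □φ w (Eq.refl k)
  axiom-sound (Four k φ) w = ¬×¬-intro λ □φ v r u r′ → □φ u (Eq.trans k r r′)
  axiom-sound (Five k φ) w = ¬×¬-intro λ ¬□φ v r □φ → ¬□φ λ u r′ → □φ u (Eq.trans k (Eq.sym k r) r′)
  axiom-sound (Comm φ) w = ¬×¬-intro FI⇒IF , ¬×¬-intro IF⇒FI
    where
      FI⇒IF : w ⊩ □ F (□ I φ) → w ⊩ □ I (□ F φ)
      FI⇒IF □□φ u wIu v uFv with C1→ w v (u , wIu , uFv)
      ... | u′ , wFu′ , u′Iv = □□φ u′ wFu′ v u′Iv
      IF⇒FI : w ⊩ □ I (□ F φ) → w ⊩ □ F (□ I φ)
      IF⇒FI □□φ u wFu v uIv with C1← w v (u , wFu , uIv)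
      ... | u′ , wIu′ , u′Fv = □□φ u′ wIu′ v u′Fv
  axiom-sound AtLeast w = ⊩-⋁ w (∈-map⁺ t (∈-allFin (proj₁ (C5 w)))) (proj₂ (C5 w))
  axiom-sound (AtMost x y x≢y) w = ¬×¬-intro λ tx ty → contradiction (trans (sym ty) (C4 w x y tx x≢y)) λ ()
  axiom-sound (Funct X x) w = ¬×¬-intro λ (cnX , tx) v wIv → ¬×¬-intro λ cnX′ →
    trans (sym (C2 w v (λ p → trans (⊩-cn w cnX p) (sym (⊩-cn v cnX′ p))) wIv x)) tx
  axiom-sound (Indep⁺ p) w = ¬×¬-intro λ pw v wFv → trans (sym (C3 w v wFv p)) pw
  axiom-sound (Indep⁻ p) w = ¬×¬-intro λ ¬pw v wFv pv → ¬pw (trans (C3 w v wFv p) pv)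

  sound : ∀ {φ} → ⊢ φ → ∀ w → w ⊩ φ
  sound (ax a) w = axiom-sound a w
  sound (mp ⊢φ ⊢φ⇒ψ) w = ⊩-⇒ w (sound ⊢φ⇒ψ w) (sound ⊢φ w)
  sound (nec k ⊢φ) w v _ = sound ⊢φ v

data Schema (k : ℕ) : Set where
  var  : Fin k → Schema k
  ¬ₛ_  : Schema k → Schema k
  _∧ₛ_ : Schema k → Schema k → Schema k

infix  8 ¬ₛ_
infixr 6 _∧ₛ_

module _ {k : ℕ} where

  infixr 5 _∨ₛ_
  infixr 4 _⇒ₛ_

  _⇒ₛ_ _∨ₛ_ : Schema k → Schema k → Schema k
  P ⇒ₛ Q = ¬ₛ (P ∧ₛ ¬ₛ Q)
  P ∨ₛ Q = ¬ₛ (¬ₛ P ∧ₛ ¬ₛ Q)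

  evalₛ : Vec Bool k → Schema k → Bool
  evalₛ a (var i)  = lookup a i
  evalₛ a (¬ₛ P)   = not (evalₛ a P)
  evalₛ a (P ∧ₛ Q) = evalₛ a P ∧ evalₛ a Q

allAssignments : ∀ k → (Vec Bool k → Bool) → Bool
allAssignments zero    f = f []
allAssignments (suc k) f = allAssignments k (f ∘ (false ∷_)) ∧ allAssignments k (f ∘ (true ∷_))

allAssignments-sound : ∀ k f → allAssignments k f ≡ true → ∀ a → f a ≡ true
allAssignments-sound zero    f holds []          = holds
allAssignments-sound (suc k) f holds (false ∷ a) = allAssignments-sound k _ (∧-conicalˡ _ _ holds) a
allAssignments-sound (suc k) f holds (true ∷ a)  = allAssignments-sound k _ (∧-conicalʳ _ _ holds) a

IsTautology : ∀ {k} → Schema k → Set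
IsTautology {k} P = So (allAssignments k (λ a → evalₛ a P))

x₀ : ∀ {k} → Schema (suc k)
x₀ = var zero
x₁ : ∀ {k} → Schema (suc (suc k))
x₁ = var (suc zero)
x₂ : ∀ {k} → Schema (suc (suc (suc k)))
x₂ = var (suc (suc zero))
x₃ : ∀ {k} → Schema (suc (suc (suc (suc k))))
x₃ = var (suc (suc (suc zero)))

module Derivations {n m : ℕ} where

  Φ : Set
  Φ = Fm n m

  infix 40 _⟨_⟩
  _⟨_⟩ : ∀ {k} → Schema k → Vec Φ k → Φ
  var i    ⟨ ρ ⟩ = lookup ρ i
  (¬ₛ P)   ⟨ ρ ⟩ = ~ P ⟨ ρ ⟩
  (P ∧ₛ Q) ⟨ ρ ⟩ = P ⟨ ρ ⟩ ∧' Q ⟨ ρ ⟩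

  beval-⟨⟩ : ∀ {k} v (P : Schema k) ρ → beval v (P ⟨ ρ ⟩) ≡ evalₛ (Vec.map (beval v) ρ) P
  beval-⟨⟩ v (var i)  ρ = sym (lookup-map i (beval v) ρ)
  beval-⟨⟩ v (¬ₛ P)   ρ = cong not (beval-⟨⟩ v P ρ)
  beval-⟨⟩ v (P ∧ₛ Q) ρ = cong₂ _∧_ (beval-⟨⟩ v P ρ) (beval-⟨⟩ v Q ρ)

  -- For a concrete schema IsTautology P normalises to ⊤, so the implicit argument fills itself in.
  tautology : ∀ {k} (P : Schema k) {_ : IsTautology P} (ρ : Vec Φ k) → ⊢ P ⟨ ρ ⟩
  tautology {k} P {holds} ρ = ax (taut λ v →
    trans (beval-⟨⟩ v P ρ) (allAssignments-sound k _ (Equivalence.to T-≡ holds) _))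

  mp₂ : ∀ {a b c : Φ} → ⊢ a → ⊢ b → ⊢ (a ⇒ b ⇒ c) → ⊢ c
  mp₂ ⊢a ⊢b ⊢a⇒b⇒c = mp ⊢b (mp ⊢a ⊢a⇒b⇒c)

  ⊢⊤ : ⊢ ⊤'
  ⊢⊤ = tautology (x₀ ⇒ₛ x₀) (t zero ∷ [])

  ⇒-refl : ∀ {a : Φ} → ⊢ (a ⇒ a)
  ⇒-refl {a} = tautology (x₀ ⇒ₛ x₀) (a ∷ [])

  ⇒-trans : ∀ {a b c : Φ} → ⊢ (a ⇒ b) → ⊢ (b ⇒ c) → ⊢ (a ⇒ c)
  ⇒-trans {a} {b} {c} p q = mp₂ p q (tautology ((x₀ ⇒ₛ x₁) ⇒ₛ (x₁ ⇒ₛ x₂) ⇒ₛ x₀ ⇒ₛ x₂) (a ∷ b ∷ c ∷ []))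

  ⇒-const : ∀ {g a : Φ} → ⊢ a → ⊢ (g ⇒ a)
  ⇒-const {g} {a} p = mp p (tautology (x₁ ⇒ₛ x₀ ⇒ₛ x₁) (g ∷ a ∷ []))

  ⇒-∧ : ∀ {a b c : Φ} → ⊢ (a ⇒ b) → ⊢ (a ⇒ c) → ⊢ (a ⇒ (b ∧' c))
  ⇒-∧ {a} {b} {c} p q = mp₂ p q (tautology ((x₀ ⇒ₛ x₁) ⇒ₛ (x₀ ⇒ₛ x₂) ⇒ₛ x₀ ⇒ₛ x₁ ∧ₛ x₂) (a ∷ b ∷ c ∷ []))

  ⇒-mp : ∀ {g a b : Φ} → ⊢ (g ⇒ a) → ⊢ (g ⇒ (a ⇒ b)) → ⊢ (g ⇒ b)
  ⇒-mp {g} {a} {b} p q = mp₂ p q (tautology ((x₀ ⇒ₛ x₁) ⇒ₛ (x₀ ⇒ₛ x₁ ⇒ₛ x₂) ⇒ₛ x₀ ⇒ₛ x₂) (g ∷ a ∷ b ∷ []))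

  ⇒-absurd : ∀ {g a φ : Φ} → ⊢ (g ⇒ a) → ⊢ (g ⇒ ~ a) → ⊢ (g ⇒ φ)
  ⇒-absurd {g} {a} {φ} p q = mp₂ p q (tautology ((x₀ ⇒ₛ x₁) ⇒ₛ (x₀ ⇒ₛ ¬ₛ x₁) ⇒ₛ x₀ ⇒ₛ x₂) (g ∷ a ∷ φ ∷ []))

  contrapose : ∀ {a b : Φ} → ⊢ (a ⇒ b) → ⊢ (~ b ⇒ ~ a)
  contrapose {a} {b} p = mp p (tautology ((x₀ ⇒ₛ x₁) ⇒ₛ ¬ₛ x₁ ⇒ₛ ¬ₛ x₀) (a ∷ b ∷ []))

  ∧-projˡ : ∀ {a b : Φ} → ⊢ ((a ∧' b) ⇒ a)
  ∧-projˡ {a} {b} = tautology (x₀ ∧ₛ x₁ ⇒ₛ x₀) (a ∷ b ∷ [])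

  ∧-projʳ : ∀ {a b : Φ} → ⊢ ((a ∧' b) ⇒ b)
  ∧-projʳ {a} {b} = tautology (x₀ ∧ₛ x₁ ⇒ₛ x₁) (a ∷ b ∷ [])

  ¬¬-elim : ∀ {a : Φ} → ⊢ (~ ~ a ⇒ a)
  ¬¬-elim {a} = tautology (¬ₛ ¬ₛ x₀ ⇒ₛ x₀) (a ∷ [])

  ¬¬-intro : ∀ {a : Φ} → ⊢ (a ⇒ ~ ~ a)
  ¬¬-intro {a} = tautology (x₀ ⇒ₛ ¬ₛ ¬ₛ x₀) (a ∷ [])

  ◇ : Mod → Φ → Φ
  ◇ k a = ~ □ k (~ a)

  □-mono : ∀ k {a b : Φ} → ⊢ (a ⇒ b) → ⊢ (□ k a ⇒ □ k b)
  □-mono k {a} {b} p = mp (nec k p) (mp (ax (K k a b))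
    (tautology ((x₀ ∧ₛ x₁ ⇒ₛ x₂) ⇒ₛ x₁ ⇒ₛ x₀ ⇒ₛ x₂) (□ k a ∷ □ k (a ⇒ b) ∷ □ k b ∷ [])))

  ◇-mono : ∀ k {a b : Φ} → ⊢ (a ⇒ b) → ⊢ (◇ k a ⇒ ◇ k b)
  ◇-mono k = contrapose ∘ □-mono k ∘ contrapose

  □-∧ : ∀ k {a b : Φ} → ⊢ ((□ k a ∧' □ k b) ⇒ □ k (a ∧' b))
  □-∧ k {a} {b} = mp₂ (□-mono k (tautology (x₀ ⇒ₛ x₁ ⇒ₛ x₀ ∧ₛ x₁) (a ∷ b ∷ []))) (ax (K k b (a ∧' b)))
    (tautology ((x₀ ⇒ₛ x₁) ⇒ₛ (x₂ ∧ₛ x₁ ⇒ₛ x₃) ⇒ₛ x₀ ∧ₛ x₂ ⇒ₛ x₃)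
               (□ k a ∷ □ k (b ⇒ (a ∧' b)) ∷ □ k b ∷ □ k (a ∧' b) ∷ []))

  ⇒-□-∧ : ∀ k {g a b : Φ} → ⊢ (g ⇒ □ k a) → ⊢ (g ⇒ □ k b) → ⊢ (g ⇒ □ k (a ∧' b))
  ⇒-□-∧ k p q = ⇒-trans (⇒-∧ p q) (□-∧ k)

  □-◇-∧ : ∀ k {a b : Φ} → ⊢ ((□ k a ∧' ◇ k b) ⇒ ◇ k (a ∧' b))
  □-◇-∧ k {a} {b} = mp (⇒-trans (□-∧ k) (□-mono k (tautology (x₀ ∧ₛ ¬ₛ (x₀ ∧ₛ x₁) ⇒ₛ ¬ₛ x₁) (a ∷ b ∷ []))))
    (tautology ((x₀ ∧ₛ x₁ ⇒ₛ x₂) ⇒ₛ x₀ ∧ₛ ¬ₛ x₂ ⇒ₛ ¬ₛ x₁) (□ k a ∷ □ k (~ (a ∧' b)) ∷ □ k (~ b) ∷ []))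

  □-elim : ∀ k {a : Φ} → ⊢ (□ k a ⇒ a)
  □-elim k {a} = ax (T k a)

  ◇-intro : ∀ k {a : Φ} → ⊢ (a ⇒ ◇ k a)
  ◇-intro k {a} = mp (□-elim k) (tautology ((x₀ ⇒ₛ ¬ₛ x₁) ⇒ₛ x₁ ⇒ₛ ¬ₛ x₀) (□ k (~ a) ∷ a ∷ []))

  ◇□-elim : ∀ k {a : Φ} → ⊢ (◇ k (□ k a) ⇒ □ k a)
  ◇□-elim k {a} = mp (ax (Five k a)) (tautology ((¬ₛ x₀ ⇒ₛ x₁) ⇒ₛ ¬ₛ x₁ ⇒ₛ x₀) (□ k a ∷ □ k (~ □ k a) ∷ []))

  opp : Mod → Mod
  opp I = F
  opp F = I

  □-comm : ∀ k {a : Φ} → ⊢ (□ k (□ (opp k) a) ⇒ □ (opp k) (□ k a))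
  □-comm F {a} = mp (ax (Comm a)) ∧-projˡ
  □-comm I {a} = mp (ax (Comm a)) ∧-projʳ

  ◇-comm : ∀ k {a : Φ} → ⊢ (◇ (opp k) (◇ k a) ⇒ ◇ k (◇ (opp k) a))
  ◇-comm k = ⇒-trans (contrapose (□-mono (opp k) ¬¬-intro))
                     (⇒-trans (contrapose (□-comm k)) (contrapose (□-mono k ¬¬-elim)))

  ◇□-□◇ : ∀ k {a : Φ} → ⊢ (◇ k (□ (opp k) a) ⇒ □ (opp k) (◇ k a))
  ◇□-□◇ k = ⇒-trans (◇-intro (opp k)) (⇒-trans (ax (Five (opp k) _)) (□-mono (opp k)
             (⇒-trans (◇-comm k) (⇒-trans (◇-mono k (◇□-elim (opp k))) (◇-mono k (□-elim (opp k)))))))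

  literal : Bool → Φ → Φ
  literal b a = if b then a else ~ a

  Rigid : Mod → Φ → Set
  Rigid k a = ⊢ (a ⇒ □ k a)

  rigid-□ : ∀ k {a : Φ} → Rigid k (□ k a)
  rigid-□ k {a} = ax (Four k a)

  rigid-◇ : ∀ k {a : Φ} → Rigid k (◇ k a)
  rigid-◇ k {a} = ax (Five k (~ a))

  rigid-¬ : ∀ k {a : Φ} → Rigid k a → Rigid k (~ a)
  rigid-¬ k r = ⇒-trans (contrapose (⇒-trans (◇-mono k r) (⇒-trans (◇□-elim k) (□-elim k)))) ¬¬-elim

  rigid-literal : ∀ k b {a : Φ} → Rigid k a → Rigid k (literal b a)
  rigid-literal k true  r = r
  rigid-literal k false r = rigid-¬ k r

  rigid-∧ : ∀ k {a b : Φ} → Rigid k a → Rigid k b → Rigid k (a ∧' b)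
  rigid-∧ k p q = ⇒-□-∧ k (⇒-trans ∧-projˡ p) (⇒-trans ∧-projʳ q)

  rigid-⊤ : ∀ k → Rigid k ⊤'
  rigid-⊤ k = ⇒-const (nec k ⊢⊤)

  rigid-⋀ : ∀ k {L} → All (Rigid k) L → Rigid k (⋀ L)
  rigid-⋀ k []       = rigid-⊤ k
  rigid-⋀ k (r ∷ rs) = rigid-∧ k r (rigid-⋀ k rs)

  rigid-◇-opp : ∀ k {a : Φ} → Rigid (opp k) a → Rigid (opp k) (◇ k a)
  rigid-◇-opp k r = ⇒-trans (◇-mono k r) (◇□-□◇ k)

  ⋀-elim : ∀ {ψ : Φ} {L} → ψ ∈ L → ⊢ (⋀ L ⇒ ψ)
  ⋀-elim (here refl) = ∧-projˡ
  ⋀-elim (there ψ∈L) = ⇒-trans ∧-projʳ (⋀-elim ψ∈L)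

  ⇒-□-⋀ : ∀ k {g : Φ} {L} → All (λ ψ → ⊢ (g ⇒ □ k ψ)) L → ⊢ (g ⇒ □ k (⋀ L))
  ⇒-□-⋀ k []       = ⇒-const (nec k ⊢⊤)
  ⇒-□-⋀ k (p ∷ ps) = ⇒-□-∧ k p (⇒-□-⋀ k ps)

  ⋁-intro : ∀ {ψ : Φ} {L} → ψ ∈ L → ⊢ (ψ ⇒ ⋁ L)
  ⋁-intro {ψ} {_ ∷ L} (here refl) = tautology (x₀ ⇒ₛ x₀ ∨ₛ x₁) (ψ ∷ ⋁ L ∷ [])
  ⋁-intro {ψ} {a ∷ L} (there ψ∈L) = ⇒-trans (⋁-intro ψ∈L) (tautology (x₁ ⇒ₛ x₀ ∨ₛ x₁) (a ∷ ⋁ L ∷ []))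

  ⋁-elim : ∀ {φ : Φ} {L} → All (λ ψ → ⊢ (ψ ⇒ φ)) L → ⊢ (⋁ L ⇒ φ)
  ⋁-elim {φ} [] = tautology (¬ₛ (x₀ ⇒ₛ x₀) ⇒ₛ x₁) (t zero ∷ φ ∷ [])
  ⋁-elim {φ} {a ∷ L} (p ∷ ps) = mp₂ p (⋁-elim ps)
    (tautology ((x₀ ⇒ₛ x₂) ⇒ₛ (x₁ ⇒ₛ x₂) ⇒ₛ x₀ ∨ₛ x₁ ⇒ₛ x₂) (a ∷ ⋁ L ∷ φ ∷ []))

  ⇒-reflexive : ∀ {a b : Φ} → a ≡ b → ⊢ (a ⇒ b)
  ⇒-reflexive refl = ⇒-refl

  ⇒-curry : ∀ {a b c : Φ} → ⊢ ((a ∧' b) ⇒ c) → ⊢ (a ⇒ b ⇒ c)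
  ⇒-curry {a} {b} {c} p = mp p (tautology ((x₀ ∧ₛ x₁ ⇒ₛ x₂) ⇒ₛ x₀ ⇒ₛ x₁ ⇒ₛ x₂) (a ∷ b ∷ c ∷ []))

  ⇒-swap : ∀ {a b c : Φ} → ⊢ (a ⇒ b ⇒ c) → ⊢ (b ⇒ a ⇒ c)
  ⇒-swap {a} {b} {c} p = mp p (tautology ((x₀ ⇒ₛ x₁ ⇒ₛ x₂) ⇒ₛ x₁ ⇒ₛ x₀ ⇒ₛ x₂) (a ∷ b ∷ c ∷ []))

  ⇒-literal-true : ∀ {b} {x a : Φ} → b ≡ true → ⊢ (x ⇒ literal b a) → ⊢ (x ⇒ a)
  ⇒-literal-true refl p = p

  ⇒-literal-false : ∀ {b} {x a : Φ} → b ≡ false → ⊢ (x ⇒ literal b a) → ⊢ (x ⇒ ~ a)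
  ⇒-literal-false refl p = p

  by-cases : ∀ {g φ : Φ} {L} → ⊢ (g ⇒ ⋁ L) → All (λ ψ → ⊢ ((g ∧' ψ) ⇒ φ)) L → ⊢ (g ⇒ φ)
  by-cases g⇒⋁L cases = ⇒-mp g⇒⋁L (⇒-swap (⋁-elim (All.map (⇒-swap ∘ ⇒-curry) cases)))

  by-choice : ∀ {A : Set} (xs : List A) {Q} (P : Fin Q → A → Φ) {g φ : Φ}
            → (∀ q → ⊢ (g ⇒ ⋁ (map (P q) xs)))
            → (∀ (f : Fin Q → A) → ⊢ ((g ∧' ⋀ (tabulate (λ q → P q (f q)))) ⇒ φ))
            → ⊢ (g ⇒ φ)
  by-choice xs {zero} P {g} {φ} _ chosen = mp₂ (chosen λ ()) ⊢⊤
    (tautology ((x₀ ∧ₛ x₁ ⇒ₛ x₂) ⇒ₛ x₁ ⇒ₛ x₀ ⇒ₛ x₂) (g ∷ ⊤' ∷ φ ∷ []))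
  by-choice xs {suc Q} P {g} {φ} alternatives chosen =
    by-cases (alternatives zero) (All.map⁺ (All.universal choose-rest xs))
    where
      choose-rest : ∀ x → ⊢ ((g ∧' P zero x) ⇒ φ)
      choose-rest x = by-choice xs (P ∘ suc) (λ q → ⇒-trans ∧-projˡ (alternatives (suc q))) λ f →
        ⇒-trans (tautology ((x₀ ∧ₛ x₁) ∧ₛ x₂ ⇒ₛ x₀ ∧ₛ x₁ ∧ₛ x₂)
                           (g ∷ P zero x ∷ ⋀ (tabulate (λ q → P (suc q) (f q))) ∷ []))
                (chosen (x Vector.∷ f))

  by-literals : ∀ {Q} (ψ : Fin Q → Φ) {g φ : Φ}
              → (∀ (s : Fin Q → Bool) → ⊢ ((g ∧' ⋀ (tabulate (λ q → literal (s q) (ψ q)))) ⇒ φ))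
              → ⊢ (g ⇒ φ)
  by-literals ψ = by-choice (true ∷ false ∷ []) (λ q b → literal b (ψ q))
    (λ q → ⇒-const (tautology (x₀ ∨ₛ ¬ₛ x₀ ∨ₛ ¬ₛ (x₁ ⇒ₛ x₁)) (ψ q ∷ t zero ∷ [])))

  ⋀-⋁-elim : ∀ {a : Φ} L → ⊢ ⋁ L → ⊢ (⋀ (map (_⇒ a) L) ⇒ a)
  ⋀-⋁-elim {a} L ⊢⋁L = mp ⊢⋁L (⋁-elim {L = L} (All.tabulate λ c∈L →
    ⇒-swap (⋀-elim (∈-map⁺ (_⇒ a) c∈L))))

  □-intro-cell : ∀ k b {x c a : Φ} → ⊢ (x ⇒ literal b (◇ k c)) → (b ≡ true → ⊢ (c ⇒ a)) → ⊢ (x ⇒ □ k (c ⇒ a))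
  □-intro-cell k true  _      c⇒a = ⇒-const (nec k (c⇒a refl))
  □-intro-cell k false {c = c} {a} x⇒¬◇c _ =
    ⇒-trans x⇒¬◇c (⇒-trans ¬¬-elim (□-mono k (tautology (¬ₛ x₀ ⇒ₛ x₀ ⇒ₛ x₁) (c ∷ a ∷ []))))

  -- The cells c q cover every □k-class; a cell occurring in the class of x is handled by the
  -- last premise and a cell not occurring there is empty.
  □-intro-cells : ∀ k {Q} (c : Fin Q → Φ) (occurs : Fin Q → Bool) {x ρ ψ : Φ}
                → ⊢ ⋁ (tabulate c) → ⊢ (x ⇒ □ k ρ)
                → (∀ q → ⊢ (x ⇒ literal (occurs q) (◇ k (c q))))
                → (∀ q → occurs q ≡ true → ⊢ ((c q ∧' ρ) ⇒ ψ))
                → ⊢ (x ⇒ □ k ψ)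
  □-intro-cells k c occurs {x} {ρ} {ψ} ⊢⋁c x⇒□ρ x⇒literal cell⇒ψ =
    ⇒-trans (⇒-□-∧ k x⇒□ρ (⇒-□-⋀ k (All.map⁺ (All.tabulate⁺ cell))))
            (□-mono k (mp (⋀-⋁-elim (tabulate c) ⊢⋁c) (tautology ((x₁ ⇒ₛ x₀ ⇒ₛ x₂) ⇒ₛ x₀ ∧ₛ x₁ ⇒ₛ x₂)
                                                      (ρ ∷ ⋀ (map (_⇒ (ρ ⇒ ψ)) (tabulate c)) ∷ ψ ∷ []))))
    where
      cell : ∀ q → ⊢ (x ⇒ □ k (c q ⇒ (ρ ⇒ ψ)))
      cell q = □-intro-cell k (occurs q) (x⇒literal q) (⇒-curry ∘ cell⇒ψ q)

  ◇-absent : ∀ k {x c φ : Φ} → ⊢ (x ⇒ c) → ⊢ (x ⇒ ~ ◇ k c) → ⊢ (x ⇒ φ)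
  ◇-absent k x⇒c x⇒¬◇c = ⇒-absurd (⇒-trans x⇒c (◇-intro k)) x⇒¬◇c

  ◇-witness : ∀ k {x ρ c ψ : Φ} → ⊢ (x ⇒ □ k ρ) → ⊢ (x ⇒ ◇ k c) → ⊢ ((c ∧' ρ) ⇒ ~ ψ) → ⊢ (x ⇒ ~ □ k ψ)
  ◇-witness k {ρ = ρ} {c} x⇒□ρ x⇒◇c cρ⇒¬ψ =
    ⇒-trans (⇒-∧ x⇒□ρ x⇒◇c) (⇒-trans (□-◇-∧ k) (⇒-trans (◇-mono k ρc⇒¬ψ) (contrapose (□-mono k ¬¬-intro))))
    where
      ρc⇒¬ψ = ⇒-trans (tautology (x₀ ∧ₛ x₁ ⇒ₛ x₁ ∧ₛ x₀) (ρ ∷ c ∷ [])) cρ⇒¬ψ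

funToFin-cong : ∀ {a b} {f g : Fin a → Fin b} → f ≗ g → funToFin f ≡ funToFin g
funToFin-cong {zero}  _   = refl
funToFin-cong {suc a} f≗g = cong₂ combine (f≗g zero) (funToFin-cong (f≗g ∘ suc))

module Completeness {n m : ℕ} where
  open Derivations {n} {m}

  #val #tab : ℕ
  #val = 2 ^ n
  #tab = suc m ^ #val

  valuation : Fin #val → Fin n → Bool
  valuation i = Inverse.to 2↔Bool ∘ finToFun i

  index : (Fin n → Bool) → Fin #val
  index X = funToFin (Inverse.from 2↔Bool ∘ X)

  valuation-index : ∀ X → valuation (index X) ≗ X
  valuation-index X p =
    trans (cong (Inverse.to 2↔Bool) (finToFun-funToFin _ p)) (Inverse.strictlyInverseˡ 2↔Bool (X p))

  valuation-injective : ∀ {i i′} → valuation i ≗ valuation i′ → i ≡ i′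
  valuation-injective {i} {i′} same = begin
    i                              ≡⟨ funToFin-finToFin {n} i ⟨
    funToFin (finToFun {2} {n} i)  ≡⟨ funToFin-cong (Injection.injective (↔⇒↣ 2↔Bool) ∘ same) ⟩
    funToFin (finToFun {2} {n} i′) ≡⟨ funToFin-finToFin {n} i′ ⟩
    i′                             ∎
    where open ≡-Reasoning

  table : Fin #tab → Fin #val → Fin (suc m)
  table = finToFun

  γ : Fin #val → Φ
  γ i = cn (valuation i)

  δ : Fin #tab → Φ
  δ j = □ I (⋀ (tabulate (λ i → γ i ⇒ t (table j i))))

  σ : (Fin #val → Bool) → Φ
  σ occI = ⋀ (tabulate (λ i → literal (occI i) (◇ I (γ i))))

  τ : (Fin #tab → Bool) → Φ
  τ occF = ⋀ (tabulate (λ j → literal (occF j) (◇ F (δ j))))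

  χ : Fin #val → (Fin #val → Bool) → Fin #tab → (Fin #tab → Bool) → Φ
  χ i occI j occF = ((γ i ∧' σ occI) ∧' δ j) ∧' τ occF

  γ-literal : ∀ i p → ⊢ (γ i ⇒ literal (valuation i p) (atom p))
  γ-literal i p = ⋀-elim (∈-map⁺ _ (∈-allFin p))

  ⊢⋁γ : ⊢ ⋁ (tabulate γ)
  ⊢⋁γ = mp ⊢⊤ (by-literals atom λ X →
    ⇒-trans ∧-projʳ (⇒-trans (⇒-reflexive (cong ⋀ (literals≡ X))) (⋁-intro (∈-tabulate⁺ (index X)))))
    where
      literals≡ : ∀ X → tabulate (λ p → literal (X p) (atom p))
                      ≡ map (λ p → literal (valuation (index X) p) (atom p)) (allFin n)
      literals≡ X = trans (tabulate-cong λ p → cong (λ b → literal b (atom p)) (sym (valuation-index X p)))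
                          (sym (map-tabulate id _))

  rigid-cn : ∀ X → Rigid F (cn X)
  rigid-cn X = rigid-⋀ F (All.map⁺ (All.universal (λ p → rigid-literal F (X p) (ax (Indep⁺ p))) (allFin n)))

  -- If no value were forced throughout the □I-class, the contrapositive of Funct would exclude
  -- every t x wherever c holds there, and AtLeast would leave no world of the class satisfying c.
  □-determined : ∀ {c : Φ} → (∀ x → ⊢ ((c ∧' t x) ⇒ □ I (c ⇒ t x)))
               → ⊢ ⋁ (map (λ x → □ I (c ⇒ t x)) (allFin (suc m)))
  □-determined {c} funct = mp₂ ¬◇c⇒ ¬⋁⇒ (tautology ((¬ₛ x₁ ⇒ₛ x₀) ⇒ₛ (¬ₛ x₀ ⇒ₛ ¬ₛ x₁) ⇒ₛ x₀) (⋁ L ∷ ◇ I c ∷ []))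
    where
      L = map (λ x → □ I (c ⇒ t x)) (allFin (suc m))
      ¬◇c⇒ : ⊢ (~ ◇ I c ⇒ ⋁ L)
      ¬◇c⇒ = ⇒-trans ¬¬-elim (⇒-trans (□-mono I (tautology (¬ₛ x₀ ⇒ₛ x₀ ⇒ₛ x₁) (c ∷ t zero ∷ [])))
                                      (⋁-intro (∈-map⁺ (λ x → □ I (c ⇒ t x)) (∈-allFin zero))))
      excluded : ∀ x → ⊢ (~ ⋁ L ⇒ □ I (~ (c ∧' t x)))
      excluded x = ⇒-trans (contrapose (⋁-intro (∈-map⁺ (λ x → □ I (c ⇒ t x)) (∈-allFin x))))
                           (⇒-trans (rigid-¬ I (rigid-□ I)) (□-mono I (contrapose (funct x))))
      N = ⋀ (map (λ x → ~ (c ∧' t x)) (allFin (suc m)))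
      value-excluded : ∀ x → ⊢ (t x ⇒ N ⇒ ~ c)
      value-excluded x = mp (⋀-elim (∈-map⁺ (λ x → ~ (c ∧' t x)) (∈-allFin x)))
        (tautology ((x₀ ⇒ₛ ¬ₛ (x₁ ∧ₛ x₂)) ⇒ₛ x₂ ⇒ₛ x₀ ⇒ₛ ¬ₛ x₁) (N ∷ c ∷ t x ∷ []))
      no-value : ⊢ (N ⇒ ~ c)
      no-value = mp (ax AtLeast) (⋁-elim (All.map⁺ (All.universal value-excluded (allFin (suc m)))))
      ¬⋁⇒ : ⊢ (~ ⋁ L ⇒ ~ ◇ I c)
      ¬⋁⇒ = ⇒-trans (⇒-□-⋀ I (All.map⁺ (All.universal excluded (allFin (suc m)))))
                    (⇒-trans (□-mono I no-value) ¬¬-intro)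

  ⊢⋁δ : ⊢ ⋁ (tabulate δ)
  ⊢⋁δ = mp ⊢⊤ (by-choice (allFin (suc m)) (λ i x → □ I (γ i ⇒ t x))
    (λ i → ⇒-const (□-determined (λ x → ax (Funct (valuation i) x)))) λ f →
    ⇒-trans ∧-projʳ (⇒-trans (⇒-□-⋀ I (All.tabulate⁺ λ i → ⋀-elim (∈-tabulate⁺ {f = λ i → □ I (γ i ⇒ t (f i))} i)))
                    (⇒-trans (⇒-reflexive (cong (□ I ∘ ⋀) (table-funToFin f)))
                             (⋁-intro (∈-tabulate⁺ (funToFin f))))))
    where
      table-funToFin : ∀ f → tabulate (λ i → γ i ⇒ t (f i)) ≡ tabulate (λ i → γ i ⇒ t (table (funToFin f) i))
      table-funToFin f = tabulate-cong λ i → cong (λ x → γ i ⇒ t x) (sym (finToFun-funToFin f i))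

  rigid-I-σ : ∀ occI → Rigid I (σ occI)
  rigid-I-σ occI = rigid-⋀ I (All.tabulate⁺ λ i → rigid-literal I (occI i) (rigid-◇ I))

  rigid-F-σ : ∀ occI → Rigid F (σ occI)
  rigid-F-σ occI = rigid-⋀ F (All.tabulate⁺ λ i → rigid-literal F (occI i) (rigid-◇-opp I (rigid-cn _)))

  rigid-F-τ : ∀ occF → Rigid F (τ occF)
  rigid-F-τ occF = rigid-⋀ F (All.tabulate⁺ λ j → rigid-literal F (occF j) (rigid-◇ F))

  rigid-I-τ : ∀ occF → Rigid I (τ occF)
  rigid-I-τ occF = rigid-⋀ I (All.tabulate⁺ λ j → rigid-literal I (occF j) (rigid-◇-opp F (rigid-□ I)))

  module _ {i : Fin #val} {occI : Fin #val → Bool} {j : Fin #tab} {occF : Fin #tab → Bool} where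

    χ⇒γ : ⊢ (χ i occI j occF ⇒ γ i)
    χ⇒γ = tautology (((x₀ ∧ₛ x₁) ∧ₛ x₂) ∧ₛ x₃ ⇒ₛ x₀) (γ i ∷ σ occI ∷ δ j ∷ τ occF ∷ [])

    χ⇒δ : ⊢ (χ i occI j occF ⇒ δ j)
    χ⇒δ = tautology (((x₀ ∧ₛ x₁) ∧ₛ x₂) ∧ₛ x₃ ⇒ₛ x₂) (γ i ∷ σ occI ∷ δ j ∷ τ occF ∷ [])

    χ⇒σ-literal : ∀ i′ → ⊢ (χ i occI j occF ⇒ literal (occI i′) (◇ I (γ i′)))
    χ⇒σ-literal i′ = ⇒-trans (tautology (((x₀ ∧ₛ x₁) ∧ₛ x₂) ∧ₛ x₃ ⇒ₛ x₁) (γ i ∷ σ occI ∷ δ j ∷ τ occF ∷ []))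
                             (⋀-elim (∈-tabulate⁺ i′))

    χ⇒τ-literal : ∀ j′ → ⊢ (χ i occI j occF ⇒ literal (occF j′) (◇ F (δ j′)))
    χ⇒τ-literal j′ = ⇒-trans ∧-projʳ (⋀-elim (∈-tabulate⁺ j′))

    χ⇒decision : ⊢ (χ i occI j occF ⇒ t (table j i))
    χ⇒decision = ⇒-mp χ⇒γ (⇒-trans χ⇒δ (⇒-trans (□-elim I)
                                   (⋀-elim (∈-tabulate⁺ {f = λ i → γ i ⇒ t (table j i)} i))))

  module Canonical (occI : Fin #val → Bool) (occF : Fin #tab → Bool) where

    record World : Set where
      constructor world
      field
        val : Fin #val
        tab : Fin #tab
        .val-occurs : occI val ≡ true
        .tab-occurs : occF tab ≡ true
    open World

    #cells : Mod → ℕ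
    #cells I = #val
    #cells F = #tab

    occurs : ∀ k → Fin (#cells k) → Bool
    occurs I = occI
    occurs F = occF

    cell : ∀ k → Fin (#cells k) → Φ
    cell I = γ
    cell F = δ

    Rel : Mod → World → World → Set
    Rel I = _≡_ on tab
    Rel F = _≡_ on val

    move : ∀ k (w : World) (c : Fin (#cells k)) → .(occurs k c ≡ true) → World
    move I (world _ j _ occ′) i occ = world i j occ occ′
    move F (world i _ occ′ _) j occ = world i j occ′ occ

    Rel-move : ∀ k w c .occ → Rel k w (move k w c occ)
    Rel-move I w c occ = refl
    Rel-move F w c occ = refl

    neighbour-is-move : ∀ k {w v} → Rel k w v → ∀ {P : World → Set} → (∀ c .occ → P (move k w c occ)) → P v
    neighbour-is-move I {v = world i _ occ _} refl moved = moved i occ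
    neighbour-is-move F {v = world _ j _ occ} refl moved = moved j occ

    decision : World → Fin (suc m)
    decision w = table (tab w) (val w)

    decision-sound : ∀ w x → does (decision w Fin.≟ x) ≡ true → decision w ≡ x
    decision-sound w x with decision w Fin.≟ x
    ... | yes d≡x = λ _ → d≡x
    ... | no  _   = λ ()

    model : MDM n m
    model = record
      { W     = World
      ; R     = Rel
      ; equiv = λ { I → On.isEquivalence tab isEquivalence ; F → On.isEquivalence val isEquivalence }
      ; V₀    = valuation ∘ val
      ; Vd    = λ w x → does (decision w Fin.≟ x)
      ; C1→   = λ { (world i _ i-occ _) (world _ j _ j-occ) _ → world i j i-occ j-occ , refl , refl }
      ; C1←   = λ { (world _ j _ j-occ) (world i _ i-occ _) _ → world i j i-occ j-occ , refl , refl }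
      ; C2    = λ w v same wIv x → cong (λ d → does (d Fin.≟ x)) (cong₂ table wIv (valuation-injective same))
      ; C3    = λ w v wFv p → cong (λ i → valuation i p) wFv
      ; C4    = λ w x y dx x≢y → dec-false (decision w Fin.≟ y) (x≢y ∘ trans (sym (decision-sound w x dx)))
      ; C5    = λ w → decision w , dec-true (decision w Fin.≟ decision w) refl
      }

    infix 4 _⊩_
    _⊩_ : World → Φ → Set
    _⊩_ = _⊨_ model

    HoldsAtCell : ∀ k → World → Φ → Fin (#cells k) → Set
    HoldsAtCell k w φ c = .(occ : occurs k c ≡ true) → move k w c occ ⊩ φ

    □-cells : ∀ k {w φ} → (∀ c → HoldsAtCell k w φ c) → w ⊩ □ k φ
    □-cells k {φ = φ} holds v wRv = neighbour-is-move k wRv {P = _⊩ φ} holds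

    holdsAtCell? : ∀ k w φ → (∀ v → Dec (v ⊩ φ)) → ∀ c → Dec (HoldsAtCell k w φ c)
    holdsAtCell? k w φ _⊩φ? c with occurs k c Bool.≟ true
    ... | yes occ = map′ (λ φ-holds _ → φ-holds) (λ holds → holds occ) (move k w c occ ⊩φ?)
    ... | no ¬occ = yes λ occ → contradiction-irr occ ¬occ

    ⊩? : ∀ φ w → Dec (w ⊩ φ)
    ⊩? (atom p) w = valuation (val w) p Bool.≟ true
    ⊩? (t x)    w = does (decision w Fin.≟ x) Bool.≟ true
    ⊩? (~ φ)    w = ¬? (⊩? φ w)
    ⊩? (φ ∧' ψ) w = ⊩? φ w ×-dec ⊩? ψ w
    ⊩? (□ k φ)  w = map′ (□-cells k) (λ □φ c occ → □φ _ (Rel-move k w c occ))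
                         (all? (holdsAtCell? k w φ (⊩? φ)))

    □-counterexample : ∀ k φ w → ¬ w ⊩ □ k φ
                     → Σ (Fin (#cells k)) λ c → Σ (occurs k c ≡ true) λ occ → ¬ move k w c occ ⊩ φ
    □-counterexample k φ w ¬□φ
      with ¬∀⟶∃¬ _ (HoldsAtCell k w φ) (holdsAtCell? k w φ (⊩? φ)) (¬□φ ∘ □-cells k)
    ... | c , ¬holds with occurs k c Bool.≟ true
    ...   | yes occ = c , occ , λ φ-holds → ¬holds λ _ → φ-holds
    ...   | no ¬occ = contradiction (λ .occ → contradiction-irr occ ¬occ) ¬holds

    χʷ : World → Φ
    χʷ w = χ (val w) occI (tab w) occF

    ρ : Mod → World → Φ
    ρ I w = (σ occI ∧' δ (tab w)) ∧' τ occF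
    ρ F w = (γ (val w) ∧' σ occI) ∧' τ occF

    χ⇒□ρ : ∀ k w → ⊢ (χʷ w ⇒ □ k (ρ k w))
    χ⇒□ρ I w = ⇒-trans (tautology (((x₀ ∧ₛ x₁) ∧ₛ x₂) ∧ₛ x₃ ⇒ₛ (x₁ ∧ₛ x₂) ∧ₛ x₃)
                                  (γ (val w) ∷ σ occI ∷ δ (tab w) ∷ τ occF ∷ []))
                       (rigid-∧ I (rigid-∧ I (rigid-I-σ occI) (rigid-□ I)) (rigid-I-τ occF))
    χ⇒□ρ F w = ⇒-trans (tautology (((x₀ ∧ₛ x₁) ∧ₛ x₂) ∧ₛ x₃ ⇒ₛ (x₀ ∧ₛ x₁) ∧ₛ x₃)
                                  (γ (val w) ∷ σ occI ∷ δ (tab w) ∷ τ occF ∷ []))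
                       (rigid-∧ F (rigid-∧ F (rigid-cn _) (rigid-F-σ occI)) (rigid-F-τ occF))

    cell∧ρ⇒χ : ∀ k w c .occ → ⊢ ((cell k c ∧' ρ k w) ⇒ χʷ (move k w c occ))
    cell∧ρ⇒χ I w i _ = tautology (x₀ ∧ₛ (x₁ ∧ₛ x₂) ∧ₛ x₃ ⇒ₛ ((x₀ ∧ₛ x₁) ∧ₛ x₂) ∧ₛ x₃)
                                 (γ i ∷ σ occI ∷ δ (tab w) ∷ τ occF ∷ [])
    cell∧ρ⇒χ F w j _ = tautology (x₂ ∧ₛ (x₀ ∧ₛ x₁) ∧ₛ x₃ ⇒ₛ ((x₀ ∧ₛ x₁) ∧ₛ x₂) ∧ₛ x₃)
                                 (γ (val w) ∷ σ occI ∷ δ j ∷ τ occF ∷ [])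

    χ⇒literal : ∀ k w c → ⊢ (χʷ w ⇒ literal (occurs k c) (◇ k (cell k c)))
    χ⇒literal I w = χ⇒σ-literal
    χ⇒literal F w = χ⇒τ-literal

    ⊢⋁cell : ∀ k → ⊢ ⋁ (tabulate (cell k))
    ⊢⋁cell I = ⊢⋁γ
    ⊢⋁cell F = ⊢⋁δ

    truth⁺ : ∀ φ w → w ⊩ φ → ⊢ (χʷ w ⇒ φ)
    truth⁻ : ∀ φ w → ¬ w ⊩ φ → ⊢ (χʷ w ⇒ ~ φ)

    truth⁺ (atom p) w holds = ⇒-literal-true holds (⇒-trans χ⇒γ (γ-literal (val w) p))
    truth⁺ (t x)    w holds = subst (λ d → ⊢ (χʷ w ⇒ t d)) (decision-sound w x holds) χ⇒decision
    truth⁺ (~ φ)    w fails = truth⁻ φ w fails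
    truth⁺ (φ ∧' ψ) w (φ-holds , ψ-holds) = ⇒-∧ (truth⁺ φ w φ-holds) (truth⁺ ψ w ψ-holds)
    truth⁺ (□ k φ)  w □φ = □-intro-cells k (cell k) (occurs k) (⊢⋁cell k) (χ⇒□ρ k w) (χ⇒literal k w) λ c occ →
      ⇒-trans (cell∧ρ⇒χ k w c occ) (truth⁺ φ (move k w c occ) (□φ _ (Rel-move k w c occ)))

    truth⁻ (atom p) w fails = ⇒-literal-false (¬-not fails) (⇒-trans χ⇒γ (γ-literal (val w) p))
    truth⁻ (t x)    w fails =
      ⇒-trans χ⇒decision (ax (AtMost (decision w) x (fails ∘ dec-true (decision w Fin.≟ x))))
    truth⁻ (~ φ)    w ¬¬φ   = ⇒-trans (truth⁺ φ w (decidable-stable (⊩? φ w) ¬¬φ)) ¬¬-intro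
    truth⁻ (φ ∧' ψ) w fails with ⊩? φ w
    ... | no  ¬φ      = ⇒-trans (truth⁻ φ w ¬φ) (contrapose ∧-projˡ)
    ... | yes φ-holds = ⇒-trans (truth⁻ ψ w (fails ∘ (φ-holds ,_))) (contrapose ∧-projʳ)
    truth⁻ (□ k φ)  w ¬□φ with □-counterexample k φ w ¬□φ
    ... | c , occ , ¬φ = ◇-witness k (χ⇒□ρ k w) (⇒-literal-true occ (χ⇒literal k w c))
                                   (⇒-trans (cell∧ρ⇒χ k w c occ) (truth⁻ φ (move k w c occ) ¬φ))

  valid⇒χ⇒ : ∀ {φ} → Valid φ → ∀ i occI j occF → ⊢ (χ i occI j occF ⇒ φ)
  valid⇒χ⇒ valid i occI j occF with occI i in i-occ | occF j in j-occ
  ... | true  | true  = Canonical.truth⁺ occI occF _ (Canonical.world i j i-occ j-occ) (valid _ _)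
  ... | false | _     = ◇-absent I χ⇒γ (⇒-literal-false i-occ (χ⇒σ-literal i))
  ... | true  | false = ◇-absent F χ⇒δ (⇒-literal-false j-occ (χ⇒τ-literal j))

  complete : ∀ {φ} → Valid φ → ⊢ φ
  complete valid = mp ⊢⋁γ (⋁-elim (All.tabulate⁺ λ i →
    by-literals (◇ I ∘ γ) λ occI →
    by-cases (⇒-const ⊢⋁δ) (All.tabulate⁺ λ j →
    by-literals (◇ F ∘ δ) λ occF →
    valid⇒χ⇒ valid i occI j occF)))

theorem2 : ∀ {n m : ℕ} (φ : Fm n m) → ((⊢ φ) → Valid φ) × (Valid φ → (⊢ φ))
theorem2 φ = (λ ⊢φ M → Soundness.sound M ⊢φ) , Completeness.complete
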